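{- For a loop $W(t,B)$ with precondition $P$ and postcondition $Q$: there exists a correct invariant $I$ if and only if there exist a safe invariant $J$ and a correct summary $R$.
   Context: States form a set $S$; commands are relations $C\subseteq S\times\hat S$ with $\hat S = S \uplus \{\mathsf{err}\} \uplus \{\mathrm{brk}(s)\mid s\in S\}$ ($\mathsf{err}$: runtime error outcome; $\mathrm{brk}(s)$: early loop exit via break in state $s$). $W(t,B)$ with test $t\subseteq S$ and body $B\subseteq S\times\hat S$ is the least relation with: $\lnot t(s)\implies W(t,B)(s,s)$; $t(s)\land B(s,\mathsf{err})\implies W(t,B)(s,\mathsf{err})$; $t(s)\land B(s,\mathrm{brk}(s'))\implies W(t,B)(s,s')$; $t(s)\land B(s,s')\land W(t,B)(s',\hat s'')\implies W(t,B)(s,\hat s'')$. Invariant $I\subseteq S$ w.r.t. $P$: $P(s_0)\implies I(s_0)$, $I(s)\land t(s)\land B(s,s')\implies I(s')$; safe: also $I(s)\land t(s)\land B(s,\mathsf{err})\implies\mathit{false}$; correct w.r.t. $Q$: safe and also $I(s)\land t(s)\land B(s,\mathrm{brk}(s_n))\implies Q(s_n)$ and $I(s_n)\land\lnot t(s_n)\implies Q(s_n)$. Summary $R\subseteq S\times S$: $\lnot t(s_n)\implies R(s_n,s_n)$, $t(s)\land B(s,\mathrm{brk}(s_n))\implies R(s,s_n)$, $t(s)\land B(s,s')\land R(s',s_n)\implies R(s,s_n)$; correct w.r.t. $P,Q$: also $P(s_0)\land R(s_0,s_n)\implies Q(s_n)$. -}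

module Defs where

open import Data.Product using (_×_)
open import Data.Empty using (⊥)
open import Relation.Nullary using (¬_)

data Ŝ (S : Set) : Set where
  nrm : S → Ŝ S
  err : Ŝ S
  brk : S → Ŝ S

Pred : Set → Set₁
Pred S = S → Set

Cmd : Set → Set₁
Cmd S = S → Ŝ S → Set

Rel : Set → Set₁
Rel S = S → S → Set

data W {S : Set} (t : Pred S) (B : Cmd S) : Cmd S where
  w-exit : ∀ {s} → ¬ t s → W t B s (nrm s)
  w-err  : ∀ {s} → t s → B s err → W t B s err
  w-brk  : ∀ {s s'} → t s → B s (brk s') → W t B s (nrm s')
  w-step : ∀ {s s' ŝ} → t s → B s (nrm s') → W t B s' ŝ → W t B s ŝ

record Invariant {S : Set} (t : Pred S) (B : Cmd S) (P I : Pred S) : Set where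
  field
    init : ∀ s₀ → P s₀ → I s₀
    pres : ∀ s s' → I s → t s → B s (nrm s') → I s'

record SafeInvariant {S : Set} (t : Pred S) (B : Cmd S) (P I : Pred S) : Set where
  field
    invariant : Invariant t B P I
    safe      : ∀ s → I s → t s → B s err → ⊥

record CorrectInvariant {S : Set} (t : Pred S) (B : Cmd S) (P Q I : Pred S) : Set where
  field
    safeInvariant : SafeInvariant t B P I
    brkOK  : ∀ s sₙ → I s → t s → B s (brk sₙ) → Q sₙ
    exitOK : ∀ sₙ → I sₙ → ¬ t sₙ → Q sₙ

record Summary {S : Set} (t : Pred S) (B : Cmd S) (R : Rel S) : Set where
  field
    sum-exit : ∀ sₙ → ¬ t sₙ → R sₙ sₙ
    sum-brk  : ∀ s sₙ → t s → B s (brk sₙ) → R s sₙ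
    sum-step : ∀ s s' sₙ → t s → B s (nrm s') → R s' sₙ → R s sₙ

record CorrectSummary {S : Set} (t : Pred S) (B : Cmd S) (P Q : Pred S) (R : Rel S) : Set where
  field
    summary : Summary t B R
    correct : ∀ s₀ sₙ → P s₀ → R s₀ sₙ → Q sₙ

-- A correct invariant I makes the loop's own input–output relation s ↦ W(t,B)(s, sₙ) a correct
-- summary: along any execution from a P-state, I holds at every iteration, so Q holds at the exit.
-- Conversely, the states all of whose R-successors satisfy Q form an invariant, since R is closed
-- backwards under the body; conjoined with J, which alone supplies safety (a summary says nothing
-- about err), it is a correct invariant.
module Submission where

open import Defs
open import Data.Product using (Σ; _×_; _,_)
open import Function.Bundles using (_⇔_; mk⇔)
open import Relation.Unary using (_∩_)

Guarantees : {S : Set} → Rel S → Pred S → Pred S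
Guarantees R Q s = ∀ sₙ → R s sₙ → Q sₙ

module _ {S : Set} {t : Pred S} {B : Cmd S} where

  Exits : Rel S
  Exits s sₙ = W t B s (nrm sₙ)

  exits-summary : Summary t B Exits
  exits-summary = record
    { sum-exit = λ _ ¬ts → w-exit ¬ts
    ; sum-brk  = λ _ _ ts b → w-brk ts b
    ; sum-step = λ _ _ _ ts b w → w-step ts b w
    }

  correctInvariant-exits : ∀ {P Q I} → CorrectInvariant t B P Q I →
                           ∀ {s sₙ} → I s → Exits s sₙ → Q sₙ
  correctInvariant-exits {Q = Q} {I = I} ci = go
    where
    open CorrectInvariant ci
    open SafeInvariant safeInvariant
    go : ∀ {s sₙ} → I s → Exits s sₙ → Q sₙ
    go i (w-exit ¬ts)    = exitOK _ i ¬ts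
    go i (w-brk ts b)    = brkOK _ _ i ts b
    go i (w-step ts b w) = go (Invariant.pres invariant _ _ i ts b) w

  correctInvariant⇒correctSummary : ∀ {P Q I} → CorrectInvariant t B P Q I →
                                    CorrectSummary t B P Q Exits
  correctInvariant⇒correctSummary ci = record
    { summary = exits-summary
    ; correct = λ s₀ _ p → correctInvariant-exits ci (Invariant.init invariant s₀ p)
    }
    where open SafeInvariant (CorrectInvariant.safeInvariant ci)

  correctSummary⇒invariant : ∀ {P Q R} → CorrectSummary t B P Q R →
                             Invariant t B P (Guarantees R Q)
  correctSummary⇒invariant cs = record
    { init = λ s₀ p sₙ → correct s₀ sₙ p
    ; pres = λ s s' g ts b sₙ r → g sₙ (Summary.sum-step summary s s' sₙ ts b r)
    }
    where open CorrectSummary cs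

  safeInvariant-∩ : ∀ {P J I} → SafeInvariant t B P J → Invariant t B P I →
                    SafeInvariant t B P (J ∩ I)
  safeInvariant-∩ sj inv = record
    { invariant = record
        { init = λ s₀ p → Invariant.init invariant s₀ p , Invariant.init inv s₀ p
        ; pres = λ s s' (j , i) ts b → Invariant.pres invariant s s' j ts b
                                     , Invariant.pres inv s s' i ts b
        }
    ; safe = λ s (j , _) → safe s j
    }
    where open SafeInvariant sj

  safeInvariant∧correctSummary⇒correctInvariant :
    ∀ {P Q J R} → SafeInvariant t B P J → CorrectSummary t B P Q R →
    CorrectInvariant t B P Q (J ∩ Guarantees R Q)
  safeInvariant∧correctSummary⇒correctInvariant sj cs = record
    { safeInvariant = safeInvariant-∩ sj (correctSummary⇒invariant cs)
    ; brkOK  = λ s sₙ (_ , g) ts b → g sₙ (sum-brk s sₙ ts b)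
    ; exitOK = λ sₙ (_ , g) ¬ts → g sₙ (sum-exit sₙ ¬ts)
    }
    where open Summary (CorrectSummary.summary cs)

corollary2 : {S : Set} (t : Pred S) (B : Cmd S) (P Q : Pred S) →
    (Σ (Pred S) (λ I → CorrectInvariant t B P Q I))
      ⇔ (Σ (Pred S) (λ J → SafeInvariant t B P J) × Σ (Rel S) (λ R → CorrectSummary t B P Q R))
corollary2 t B P Q = mk⇔
  (λ (I , ci) → (I , CorrectInvariant.safeInvariant ci)
               , (Exits {t = t} {B} , correctInvariant⇒correctSummary ci))
  (λ ((J , sj) , (R , cs)) → J ∩ Guarantees R Q
                           , safeInvariant∧correctSummary⇒correctInvariant sj cs)
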